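{- Identify the countably infinite set $\Omega$ with $\omega$, and let $E=\mathrm{Self}(\Omega)$. Let $M\subseteq E$ be a submonoid that is closed in the function topology and has dense bfm-to-one maps. If for every finite $\Sigma\subseteq\Omega$ the cardinalities of the forward orbits of $M_{(\Sigma)}$ have no common finite bound, then $E_\le\preccurlyeq M$.
   Context: $\mathrm{Self}(\Omega)$ is the monoid of maps $\Omega\to\Omega$, written on the right. The function topology has subbasis $\{f:(\alpha)f=\beta\}$. A map is bfm-to-one if there is a common finite bound on the cardinalities of the preimages of all elements; $M$ has dense bfm-to-one maps if its bfm-to-one elements are dense in $M$. $U_{(\Sigma)}=\{f\in U:(\alpha)f=\alpha\ \forall\alpha\in\Sigma\}$; the forward orbit of $\alpha$ under $U$ is $(\alpha)U=\{(\alpha)f:f\in U\}$. $E_\le=\{f\in E:(\alpha)f\le\alpha\ \forall\alpha\in\omega\}$. $M_1\preccurlyeq M_2$ means there is a finite $U\subseteq E$ with $M_1\subseteq\langle M_2\cup U\rangle$, $\langle X\rangle$ the generated submonoid. -}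

module Defs where

open import Data.Nat using (ℕ; _≤_; _<_)
open import Data.List using (List; []; _∷_; length)
open import Data.List.Relation.Unary.All using (All)
open import Data.List.Relation.Unary.Any using (Any)
open import Data.List.Relation.Unary.Unique.Propositional using (Unique)
open import Data.List.Membership.Propositional using (_∈_)
open import Data.Product using (Σ; ∃; _×_; _,_)
open import Data.Sum using (_⊎_)
open import Relation.Binary.PropositionalEquality using (_≡_)

E : Set
E = ℕ → ℕ

Subset : Set₁
Subset = E → Set

-- Maps act on the right: (α)(f g) = ((α)f)g.  So "f then g" is  g ∘ f.
_⨾_ : E → E → E
(f ⨾ g) α = g (f α)

idE : E
idE α = α

_≐_ : E → E → Set
f ≐ g = ∀ α → f α ≡ g α

IsSubmonoid : Subset → Set
IsSubmonoid M = M idE × (∀ {f g} → M f → M g → M (f ⨾ g))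

AgreeOn : List ℕ → E → E → Set
AgreeOn Σ f g = All (λ α → f α ≡ g α) Σ

IsClosed : Subset → Set
IsClosed M = ∀ f → (∀ (Σ : List ℕ) → ∃ λ g → M g × AgreeOn Σ g f) → M f

BfmToOne : E → Set
BfmToOne f = ∃ λ (k : ℕ) → ∀ (β : ℕ) (xs : List ℕ) →
  Unique xs → All (λ α → f α ≡ β) xs → length xs ≤ k

DenseBfm : Subset → Set
DenseBfm M = ∀ f → M f → ∀ (Σ : List ℕ) →
  ∃ λ g → M g × BfmToOne g × AgreeOn Σ g f

Stab : Subset → List ℕ → Subset
Stab U Σ f = U f × All (λ α → f α ≡ α) Σ

InOrbit : Subset → ℕ → ℕ → Set
InOrbit U α β = ∃ λ f → U f × f α ≡ β

OrbitExceeds : Subset → ℕ → ℕ → Set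
OrbitExceeds U α k = ∃ λ (xs : List ℕ) →
  Unique xs × All (InOrbit U α) xs × k < length xs

Eleq : Subset
Eleq f = ∀ α → f α ≤ α

InGens : Subset → List E → Subset
InGens M U g = M g ⊎ Any (λ u → g ≐ u) U

composeW : List E → E
composeW []       = idE
composeW (g ∷ gs) = g ⨾ composeW gs

Generated : Subset → Subset
Generated X f = ∃ λ (gs : List E) → All X gs × f ≐ composeW gs

_≼_ : Subset → Subset → Set
M₁ ≼ M₂ = ∃ λ (U : List E) → ∀ f → M₁ f → Generated (InGens M₂ U) f

module Submission where

-- At stage n, fix Σₙ = {0,…,n} ∪ {α₀,…,αₙ₋₁}.  The unbounded orbits of M_(Σₙ) and the density of
-- bfm-to-one maps give a centre αₙ and arbitrarily many bfm-to-one moves sₙ,ⱼ ∈ M_(Σₙ) sending αₙ to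
-- distinct targets βₙ,ⱼ.  Call the reach of a point its set of images under all products
-- sₙ₋₁,ⱼₙ₋₁ ⋯ s₀,ⱼ₀ with jᵢ ≤ i; since these products have bounded fibres, only few points have a
-- reach meeting a given finite set, so one can choose βₙ,₀,…,βₙ,ₙ greedily with reaches disjoint from
-- each other, from all earlier reaches and from {0,…,n−1}.  For f ∈ E_≤ the products
-- sₙ₋₁,f(n−1) ⋯ s₀,f(0) stabilise pointwise (later moves fix each point), so by closedness they converge
-- to some m ∈ M with (αₙ)m in the reach of βₙ,f(n).  Hence f = α m d, where α : n ↦ αₙ and d reads
-- off the index of the reach containing its argument.

open import Defs
import Algebra.Properties.CommutativeSemigroup as CSemigroup
open import Data.Nat using (ℕ; zero; suc; _+_; _*_; _≤_; _<_; _≤′_; ≤′-refl; ≤′-step; z≤n; s≤s; _≟_)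
open import Data.Nat.Properties
open import Data.Nat.ListAction using (sum)
open import Data.List using (List; []; _∷_; _++_; length; map; filter; deduplicate; concat; downFrom)
open import Data.List.Properties using (length-++; length-downFrom)
open import Data.List.Relation.Unary.All as All using (All; []; _∷_)
open import Data.List.Relation.Unary.All.Properties using (filter⁺; all-filter; ¬Any⇒All¬; ++⁻)
open import Data.List.Relation.Unary.Any as Any using (Any; here; there)
import Data.List.Relation.Unary.Any.Properties as Any
open import Data.List.Relation.Unary.AllPairs using (_∷_)
open import Data.List.Relation.Unary.Unique.Propositional using (Unique)
import Data.List.Relation.Unary.Unique.Propositional.Properties as Unique
open import Data.List.Relation.Unary.Unique.DecPropositional.Properties using (deduplicate-!)
open import Data.List.Membership.Propositional using (_∈_; find; lose)
open import Data.List.Membership.Propositional.Properties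
  using (∈-map⁺; ∈-map⁻; ∈-deduplicate⁺; ∈-deduplicate⁻; ∈-++⁺ˡ; ∈-++⁺ʳ; ∈-++⁻; ∈-downFrom⁺; ∈-downFrom⁻)
open import Data.List.Membership.DecPropositional _≟_ using (_∈?_)
open import Data.List.Relation.Binary.Subset.Propositional using (_⊆_)
open import Data.Product using (∃; _×_; _,_; proj₁; proj₂; uncurry)
open import Data.Sum using (inj₁; inj₂)
open import Data.Empty using (⊥-elim)
open import Function using (_∘_; id)
open import Level using (0ℓ)
open import Relation.Nullary using (¬_; Dec; yes; no)
open import Relation.Nullary.Decidable using (decidable-stable)
open import Relation.Unary using (Pred; Decidable; ∁; _∩_)
open import Relation.Unary.Properties using (∁?)
open import Relation.Binary.Definitions using (tri<; tri≈; tri>)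
open import Relation.Binary.PropositionalEquality using (_≡_; refl; sym; trans; cong; subst; module ≡-Reasoning)

AtMost : Pred ℕ 0ℓ → ℕ → Set
AtMost P c = ∀ xs → Unique xs → All P xs → length xs ≤ c

FibresAtMost : E → ℕ → Set
FibresAtMost f k = ∀ β → AtMost (λ α → f α ≡ β) k

AtMost-mono : {P Q : Pred ℕ 0ℓ} {a b : ℕ} → (∀ {x} → P x → Q x) → a ≤ b → AtMost Q a → AtMost P b
AtMost-mono P⊆Q a≤b atMost xs distinct all = ≤-trans (atMost xs distinct (All.map P⊆Q all)) a≤b

AtMost-empty : {P : Pred ℕ 0ℓ} → (∀ {x} → ¬ P x) → AtMost P 0
AtMost-empty ¬P []       _ _        = z≤n
AtMost-empty ¬P (x ∷ xs) _ (px ∷ _) = ⊥-elim (¬P px)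

length-filter-∁ : {P : Pred ℕ 0ℓ} (P? : Decidable P) (xs : List ℕ) →
  length xs ≡ length (filter P? xs) + length (filter (∁? P?) xs)
length-filter-∁ P? []       = refl
length-filter-∁ P? (x ∷ xs) with P? x
... | yes _ = cong suc (length-filter-∁ P? xs)
... | no  _ = trans (cong suc (length-filter-∁ P? xs)) (sym (+-suc _ _))

AtMost-split : {P Q : Pred ℕ 0ℓ} (Q? : Decidable Q) {a b : ℕ} →
  AtMost (P ∩ Q) a → AtMost (P ∩ ∁ Q) b → AtMost P (a + b)
AtMost-split {P} Q? {a} {b} inQ outQ xs distinct all =
  subst (_≤ a + b) (sym (length-filter-∁ Q? xs))
    (+-mono-≤ (inQ  _ (Unique.filter⁺ Q? distinct)       (part Q?))
              (outQ _ (Unique.filter⁺ (∁? Q?) distinct) (part (∁? Q?))))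
  where
  part : {R : Pred ℕ 0ℓ} (R? : Decidable R) → All (P ∩ R) (filter R? xs)
  part R? = All.zip (filter⁺ R? all , all-filter R? xs)

AtMost-Any : {Q : ℕ → Pred ℕ 0ℓ} (Q? : ∀ j → Decidable (Q j)) {c : ℕ} (js : List ℕ) →
  (∀ {j} → j ∈ js → AtMost (Q j) c) → AtMost (λ y → Any (λ j → Q j y) js) (length js * c)
AtMost-Any Q? []       each = AtMost-empty λ ()
AtMost-Any {Q} Q? (j ∷ js) each =
  AtMost-split (Q? j) (AtMost-mono proj₂ ≤-refl (each (here refl)))
    (AtMost-mono rest ≤-refl (AtMost-Any Q? js (each ∘ there)))
  where
  rest : ∀ {y} → Any (λ j → Q j y) (j ∷ js) × ¬ Q j y → Any (λ j → Q j y) js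
  rest (here q  , ¬q) = ⊥-elim (¬q q)
  rest (there a , _)  = a

AtMost-preimage : {f : E} {k : ℕ} → FibresAtMost f k → (V : List ℕ) → AtMost (λ α → f α ∈ V) (length V * k)
AtMost-preimage {f} fibres V = AtMost-Any (λ v α → f α ≟ v) V (λ _ → fibres _)

AtMost-comap : {f : E} {k : ℕ} → FibresAtMost f k →
  {P : Pred ℕ 0ℓ} {c : ℕ} → AtMost P c → AtMost (P ∘ f) (c * k)
AtMost-comap {f} {k} fibres {P} atMost xs distinct all =
  ≤-trans (AtMost-preimage fibres image xs distinct (All.tabulate (∈-deduplicate⁺ _≟_ ∘ ∈-map⁺ f)))
          (*-monoˡ-≤ k (atMost image (deduplicate-! _≟_ (map f xs)) (All.tabulate image⊆P)))
  where
  image : List ℕ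
  image = deduplicate _≟_ (map f xs)
  image⊆P : ∀ {y} → y ∈ image → P y
  image⊆P y∈ with ∈-map⁻ f (∈-deduplicate⁻ _≟_ (map f xs) y∈)
  ... | x , x∈xs , refl = All.lookup all x∈xs

idE-fibres : FibresAtMost idE 1
idE-fibres β []          _                   _               = z≤n
idE-fibres β (x ∷ [])    _                   _               = s≤s z≤n
idE-fibres β (x ∷ y ∷ _) ((x≢y ∷ _) ∷ _) (x≡β ∷ y≡β ∷ _) = ⊥-elim (x≢y (trans x≡β (sym y≡β)))

AtMost-escape : {P : Pred ℕ 0ℓ} → Decidable P → {c : ℕ} → AtMost P c →
  ∀ {xs} → Unique xs → c < length xs → Any (∁ P) xs
AtMost-escape P? atMost {xs} distinct c<|xs| with Any.any? (∁? P?) xs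
... | yes escapes = escapes
... | no ¬escapes =
  ⊥-elim (<⇒≱ c<|xs| (atMost xs distinct (All.map (decidable-stable (P? _)) (¬Any⇒All¬ xs ¬escapes))))

length-concat-map≤ : {A : Set} (g : ℕ → List A) {p : ℕ} → (∀ j → length (g j) ≤ p) →
  (js : List ℕ) → length (concat (map g js)) ≤ length js * p
length-concat-map≤ g bounded []       = z≤n
length-concat-map≤ g bounded (j ∷ js) rewrite length-++ (g j) {concat (map g js)} =
  +-mono-≤ (bounded j) (length-concat-map≤ g bounded js)

∈⇒≤sum : ∀ {x} {xs : List ℕ} → x ∈ xs → x ≤ sum xs
∈⇒≤sum {xs = y ∷ xs} (here refl) = m≤m+n y (sum xs)
∈⇒≤sum {xs = y ∷ xs} (there x∈) = ≤-trans (∈⇒≤sum x∈) (m≤n+m (sum xs) y)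

module Construction (M : Subset) (id∈M : M idE) (⨾-closed : ∀ {f g} → M f → M g → M (f ⨾ g))
  (closed : IsClosed M) (dense : DenseBfm M)
  (unbounded : ∀ (Σ : List ℕ) (k : ℕ) → ∃ λ α → OrbitExceeds (Stab M Σ) α k) where

  record Move (Σ : List ℕ) (α β : ℕ) : Set where
    field
      fun        : E
      fun∈M      : M fun
      fixes      : All (λ γ → fun γ ≡ γ) Σ
      sends      : fun α ≡ β
      fibreBound : ℕ
      fibres     : FibresAtMost fun fibreBound

  stay : ∀ {Σ α} → Move Σ α α
  stay = record { fun = idE ; fun∈M = id∈M ; fixes = All.tabulate (λ _ → refl) ; sends = refl
                ; fibreBound = 1 ; fibres = idE-fibres }

  orbit⇒Move : ∀ {Σ α β} → InOrbit (Stab M Σ) α β → Move Σ α β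
  orbit⇒Move {Σ} {α} (f , (f∈M , f-fixes) , fα≡β) with dense f f∈M (Σ ++ α ∷ [])
  ... | g , g∈M , (k , fibres) , g≐f with ++⁻ Σ g≐f
  ...   | g≐f-on-Σ , (gα≡fα ∷ []) = record
    { fun = g ; fun∈M = g∈M ; fixes = All.zipWith (uncurry trans) (g≐f-on-Σ , f-fixes)
    ; sends = trans gα≡fα fα≡β ; fibreBound = k ; fibres = fibres }

  record Fan (Σ : List ℕ) (k : ℕ) : Set where
    field
      centre   : ℕ
      targets  : List ℕ
      distinct : Unique targets
      many     : k < length targets
      moves    : All (Move Σ centre) targets

  fan : ∀ Σ k → Fan Σ k
  fan Σ k with unbounded Σ k
  ... | α , targets , distinct , inOrbit , many = record
    { centre = α ; targets = targets ; distinct = distinct ; many = many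
    ; moves = All.map orbit⇒Move inOrbit }

  module _ {Σ k} (F : Fan Σ k) where
    open Fan F

    pick : {B : Pred ℕ 0ℓ} → Decidable B → ∃ (Move Σ centre)
    pick B? with Any.any? (∁? B?) targets
    ... | yes escapes = proj₁ (find escapes) , All.lookup moves (proj₁ (proj₂ (find escapes)))
    ... | no _        = centre , stay  -- junk; excluded by pick-avoids

    pick-avoids : {B : Pred ℕ 0ℓ} (B? : Decidable B) {c : ℕ} → AtMost B c → c ≤ k → ¬ B (proj₁ (pick B?))
    pick-avoids B? atMost c≤k with Any.any? (∁? B?) targets
    ... | yes escapes = proj₂ (proj₂ (find escapes))
    ... | no ¬escapes = ⊥-elim (¬escapes (AtMost-escape B? atMost distinct (≤-<-trans c≤k many)))

  _meets_ : List ℕ → List ℕ → Set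
  xs meets W = Any (_∈ W) xs

  _meets?_ : ∀ xs W → Dec (xs meets W)
  xs meets? W = Any.any? (_∈? W) xs

  -- reach y: the images of y under all products of the moves chosen so far, one per stage.
  record Stage : Set where
    field
      centres  : List ℕ
      used     : List ℕ
      reach    : ℕ → List ℕ
      crowding : ℕ
      spread   : ℕ

  module Step (n : ℕ) (S : Stage) where
    open Stage S

    fixed : List ℕ
    fixed = downFrom (suc n) ++ centres

    -- Bounds length (blocked j) * crowding for every j ≤ n; see length-blocked.
    budget : ℕ
    budget = (n + length used + suc n * spread) * crowding

    open Fan (fan fixed budget) public using (centre)

    choice : List ℕ → ∃ (Move fixed centre)
    choice W = pick (fan fixed budget) (λ y → reach y meets? W)

    blocked : ℕ → List ℕ
    blocked zero    = downFrom n ++ used  -- so reaches of stage-n targets lie above n, see reach-target-≥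
    blocked (suc j) = reach (proj₁ (choice (blocked j))) ++ blocked j

    target : ℕ → ℕ
    target j = proj₁ (choice (blocked j))

    move : (j : ℕ) → Move fixed centre (target j)
    move j = proj₂ (choice (blocked j))

    indices : List ℕ
    indices = downFrom (suc n)

    next : Stage
    next = record
      { centres  = centre ∷ centres
      ; used     = blocked (suc n)
      ; reach    = λ y → concat (map (λ j → reach (Move.fun (move j) y)) indices)
      ; crowding = suc n * (crowding * sum (map (Move.fibreBound ∘ move) indices))
      ; spread   = suc n * spread }

    module _ (reach-length : ∀ y → length (reach y) ≤ spread)
             (reach-crowding : ∀ W → AtMost (λ y → reach y meets W) (length W * crowding)) where

      length-blocked : ∀ j → length (blocked j) ≤ n + length used + j * spread
      length-blocked zero rewrite length-++ (downFrom n) {used} | length-downFrom n = m≤m+n _ 0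
      length-blocked (suc j) rewrite length-++ (reach (target j)) {blocked j} =
        ≤-trans (+-mono-≤ (reach-length (target j)) (length-blocked j))
                (≤-reflexive (CSemigroup.x∙yz≈y∙xz +-commutativeSemigroup spread _ (j * spread)))

      target-avoids : ∀ {j} → j ≤ n → ¬ reach (target j) meets blocked j
      target-avoids {j} j≤n = pick-avoids (fan fixed budget) (λ y → reach y meets? blocked j)
        (reach-crowding (blocked j))
        (*-monoˡ-≤ crowding (≤-trans (length-blocked j)
          (+-monoʳ-≤ (n + length used) (*-monoˡ-≤ spread (m≤n⇒m≤1+n j≤n)))))

  stage : ℕ → Stage
  stage zero    = record { centres = [] ; used = [] ; reach = _∷ [] ; crowding = 1 ; spread = 1 }
  stage (suc n) = Step.next n (stage n)

  module _ (n : ℕ) where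
    open Stage (stage n) public using (centres; used; reach; crowding; spread)
    open Step n (stage n) public using (fixed; centre; blocked; target; move; indices)

  fun : ℕ → ℕ → E
  fun n j = Move.fun (move n j)

  reach-length : ∀ n y → length (reach n y) ≤ spread n
  reach-length zero    y = ≤-refl
  reach-length (suc n) y = subst (λ m → length (reach (suc n) y) ≤ m * spread n) (length-downFrom (suc n))
    (length-concat-map≤ (λ j → reach n (fun n j y)) (λ j → reach-length n _) (indices n))

  reach-crowding : ∀ n W → AtMost (λ y → reach n y meets W) (length W * crowding n)
  reach-crowding zero    W = AtMost-mono here-only ≤-refl (AtMost-preimage idE-fibres W)
    where
    here-only : ∀ {y} → (y ∷ []) meets W → y ∈ W
    here-only (here y∈W) = y∈W
  reach-crowding (suc n) W =
    AtMost-mono (Any.map⁻ ∘ Any.concat⁻ _) (≤-reflexive regroup)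
      (AtMost-Any (λ j y → reach n (fun n j y) meets? W) (indices n) each)
    where
    K : ℕ
    K = sum (map (Move.fibreBound ∘ move n) (indices n))
    each : ∀ {j} → j ∈ indices n → AtMost (λ y → reach n (fun n j y) meets W) (length W * crowding n * K)
    each {j} j∈ =
      AtMost-mono id (*-monoʳ-≤ (length W * crowding n) (∈⇒≤sum (∈-map⁺ (Move.fibreBound ∘ move n) j∈)))
        (AtMost-comap (Move.fibres (move n j)) (reach-crowding n W))
    regroup : length (indices n) * (length W * crowding n * K) ≡ length W * crowding (suc n)
    regroup = begin
      length (indices n) * (length W * crowding n * K)
        ≡⟨ cong (_* (length W * crowding n * K)) (length-downFrom (suc n)) ⟩
      suc n * (length W * crowding n * K)
        ≡⟨ cong (suc n *_) (*-assoc (length W) (crowding n) K) ⟩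
      suc n * (length W * (crowding n * K))
        ≡⟨ CSemigroup.x∙yz≈y∙xz *-commutativeSemigroup (suc n) (length W) _ ⟩
      length W * crowding (suc n)
        ∎
      where open ≡-Reasoning

  target-avoids : ∀ {n j} → j ≤ n → ¬ reach n (target n j) meets blocked n j
  target-avoids {n} = Step.target-avoids n (stage n) (reach-length n) (reach-crowding n)

  blocked-mono : ∀ {n j j′} → j ≤′ j′ → blocked n j ⊆ blocked n j′
  blocked-mono ≤′-refl        = id
  blocked-mono (≤′-step j≤′j′) = ∈-++⁺ʳ _ ∘ blocked-mono j≤′j′

  blocked-zero⊆ : ∀ {n} j → blocked n 0 ⊆ blocked n j
  blocked-zero⊆ {n} j = blocked-mono {n} (≤⇒≤′ (z≤n {j}))

  used⊆blocked : ∀ {n} j → used n ⊆ blocked n j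
  used⊆blocked {n} j = blocked-zero⊆ j ∘ ∈-++⁺ʳ (downFrom n)

  used-mono : ∀ {n m} → n ≤′ m → used n ⊆ used m
  used-mono ≤′-refl        = id
  used-mono {m = suc m} (≤′-step n≤′m) = used⊆blocked {m} (suc m) ∘ used-mono n≤′m

  reach-target⊆later-index : ∀ {n j j′} → j < j′ → reach n (target n j) ⊆ blocked n j′
  reach-target⊆later-index {n} j<j′ = blocked-mono {n} (≤⇒≤′ j<j′) ∘ ∈-++⁺ˡ

  reach-target⊆later-stage : ∀ {n n′ j} j′ → j ≤ n → n < n′ → reach n (target n j) ⊆ blocked n′ j′
  reach-target⊆later-stage j′ j≤n n<n′ =
    used⊆blocked j′ ∘ used-mono (≤⇒≤′ n<n′) ∘ reach-target⊆later-index (s≤s j≤n)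

  reach-targets-disjoint : ∀ {n n′ j j′ y} → j ≤ n → j′ ≤ n′ →
    y ∈ reach n (target n j) → y ∈ reach n′ (target n′ j′) → (n , j) ≡ (n′ , j′)
  reach-targets-disjoint {n} {n′} {j} {j′} j≤n j′≤n′ y∈ y∈′ with <-cmp n n′
  ... | tri< n<n′ _ _ = ⊥-elim (target-avoids j′≤n′ (lose y∈′ (reach-target⊆later-stage j′ j≤n n<n′ y∈)))
  ... | tri> _ _ n′<n = ⊥-elim (target-avoids j≤n (lose y∈ (reach-target⊆later-stage j j′≤n′ n′<n y∈′)))
  ... | tri≈ _ refl _ with <-cmp j j′
  ...   | tri< j<j′ _ _ = ⊥-elim (target-avoids j′≤n′ (lose y∈′ (reach-target⊆later-index j<j′ y∈)))
  ...   | tri≈ _ refl _ = refl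
  ...   | tri> _ _ j′<j = ⊥-elim (target-avoids j≤n (lose y∈ (reach-target⊆later-index j′<j y∈′)))

  reach-target-≥ : ∀ {n j y} → j ≤ n → y ∈ reach n (target n j) → n ≤ y
  reach-target-≥ {j = j} j≤n y∈ = ≮⇒≥ λ y<n →
    target-avoids j≤n (lose y∈ (blocked-zero⊆ j (∈-++⁺ˡ (∈-downFrom⁺ y<n))))

  approx : (ℕ → ℕ) → ℕ → E
  approx f zero    = idE
  approx f (suc n) = fun n (f n) ⨾ approx f n

  approx∈M : ∀ f n → M (approx f n)
  approx∈M f zero    = id∈M
  approx∈M f (suc n) = ⨾-closed (Move.fun∈M (move n (f n))) (approx∈M f n)

  approx∈reach : ∀ {f} → Eleq f → ∀ n y → approx f n y ∈ reach n y
  approx∈reach f≤ zero    y = here refl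
  approx∈reach {f} f≤ (suc n) y =
    Any.concat⁺ (Any.map⁺ (lose (∈-downFrom⁺ (s≤s (f≤ n))) (approx∈reach f≤ n (fun n (f n) y))))

  approx-stable : ∀ f {x a b} → a ≤′ b → (∀ {i} → a ≤ i → i < b → x ∈ fixed i) → approx f b x ≡ approx f a x
  approx-stable f ≤′-refl _ = refl
  approx-stable f (≤′-step {b} a≤′b) x-fixed =
    trans (cong (approx f b) (All.lookup (Move.fixes (move b (f b))) (x-fixed (≤′⇒≤ a≤′b) ≤-refl)))
          (approx-stable f a≤′b (λ a≤i i<b → x-fixed a≤i (m≤n⇒m≤1+n i<b)))

  limit : (ℕ → ℕ) → E
  limit f x = approx f x x

  approx≡limit : ∀ f {x N} → x ≤ N → approx f N x ≡ limit f x
  approx≡limit f x≤N = approx-stable f (≤⇒≤′ x≤N) (λ x≤i _ → ∈-++⁺ˡ (∈-downFrom⁺ (s≤s x≤i)))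

  limit∈M : ∀ f → M (limit f)
  limit∈M f = closed (limit f) λ Σ →
    approx f (sum Σ) , approx∈M f (sum Σ) , All.tabulate (approx≡limit f ∘ ∈⇒≤sum)

  centre∈centres : ∀ {m i} → m < i → centre m ∈ centres i
  centre∈centres m<i = go (≤⇒≤′ m<i)
    where
    go : ∀ {m i} → suc m ≤′ i → centre m ∈ centres i
    go ≤′-refl         = here refl
    go (≤′-step m<′i) = there (go m<′i)

  limit-centre : ∀ f n → limit f (centre n) ≡ approx f n (target n (f n))
  limit-centre f n = begin
    limit f (centre n)
      ≡⟨ approx≡limit f (m≤m+n (centre n) (suc n)) ⟨
    approx f (centre n + suc n) (centre n)
      ≡⟨ approx-stable f (≤⇒≤′ (m≤n+m (suc n) (centre n))) (λ n<i _ → ∈-++⁺ʳ (downFrom _) (centre∈centres n<i)) ⟩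
    approx f (suc n) (centre n)
      ≡⟨ cong (approx f n) (Move.sends (move n (f n))) ⟩
    approx f n (target n (f n))
      ∎
    where open ≡-Reasoning

  indexPairs : ℕ → List (ℕ × ℕ)
  indexPairs zero    = []
  indexPairs (suc m) = map (m ,_) (downFrom (suc m)) ++ indexPairs m

  indexPairs-≤ : ∀ {m n j} → (n , j) ∈ indexPairs m → j ≤ n
  indexPairs-≤ {suc m} p∈ with ∈-++⁻ (map (m ,_) (downFrom (suc m))) p∈
  ... | inj₁ p∈map with ∈-map⁻ (m ,_) p∈map
  ...   | j , j∈ , refl = ≤-pred (∈-downFrom⁻ j∈)
  indexPairs-≤ {suc m} p∈ | inj₂ p∈rest = indexPairs-≤ {m} p∈rest

  ∈-indexPairs : ∀ {m n j} → j ≤ n → n < m → (n , j) ∈ indexPairs m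
  ∈-indexPairs {suc m} j≤n n<1+m with m≤n⇒m<n∨m≡n (≤-pred n<1+m)
  ... | inj₁ n<m   = ∈-++⁺ʳ _ (∈-indexPairs j≤n n<m)
  ... | inj₂ refl  = ∈-++⁺ˡ (∈-map⁺ (m ,_) (∈-downFrom⁺ (s≤s j≤n)))

  ∈?-reach-target : ∀ y → Decidable (λ ((n , j) : ℕ × ℕ) → y ∈ reach n (target n j))
  ∈?-reach-target y (n , j) = y ∈? reach n (target n j)

  decode : E
  decode y with Any.any? (∈?-reach-target y) (indexPairs (suc y))
  ... | yes found = proj₂ (proj₁ (find found))
  ... | no _      = 0

  decode-reach-target : ∀ {n j y} → j ≤ n → y ∈ reach n (target n j) → decode y ≡ j
  decode-reach-target {y = y} j≤n y∈ with Any.any? (∈?-reach-target y) (indexPairs (suc y))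
  ... | yes found with find found
  ...   | (n′ , j′) , p∈ , y∈′ = cong proj₂ (reach-targets-disjoint (indexPairs-≤ p∈) j≤n y∈′ y∈)
  decode-reach-target j≤n y∈ | no ¬found =
    ⊥-elim (¬found (lose (∈-indexPairs j≤n (s≤s (reach-target-≥ j≤n y∈))) y∈))

  decode-limit-centre : ∀ {f} → Eleq f → ∀ n → decode (limit f (centre n)) ≡ f n
  decode-limit-centre {f} f≤ n =
    trans (cong decode (limit-centre f n)) (decode-reach-target (f≤ n) (approx∈reach f≤ n (target n (f n))))

  Eleq≼M : Eleq ≼ M
  Eleq≼M = (centre ∷ decode ∷ []) , λ f f≤ →
    (centre ∷ limit f ∷ decode ∷ []) ,
    (inj₂ (here λ _ → refl) ∷ inj₁ (limit∈M f) ∷ inj₂ (there (here λ _ → refl)) ∷ []) ,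
    λ n → sym (decode-limit-centre f≤ n)

proposition34 : (M : Subset) → IsSubmonoid M → IsClosed M → DenseBfm M →
    (∀ (Σ : List ℕ) (k : ℕ) → ∃ λ (α : ℕ) → OrbitExceeds (Stab M Σ) α k) →
    Eleq ≼ M
proposition34 M (id∈M , ⨾-closed) closed dense unbounded =
  Construction.Eleq≼M M id∈M ⨾-closed closed dense unbounded
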